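{- Let $\Re$ be a commutative ring with unit element $1$, let $n\ge 2$, and let $U_n$ be the cycle with vertices $v_1,\dots,v_n$ and edges $(v_i,v_{i+1})$, $i=1,\dots,n$, where indices are taken modulo $n$ with representatives in $\{1,\dots,n\}$ (so $v_{n+1}=v_1$, $v_0=v_n$; for $n=2$ the edges $(v_1,v_2)$ and $(v_2,v_1)$ are two distinct parallel edges). Let $f_n:V(U_n)\to\Re$ and $g_n:E(U_n)\to\Re$ be a vertex-weight and an edge-weight function. Fix a vertex $v_j$ and set, for integers $k$, $v_k^1=v_{(j+k)\bmod n}$, $v_k^2=v_{(j+k+1)\bmod n}$, $v_k^3=v_{(n+j-k)\bmod n}$, $v_k^4=v_{(n+j-k-1)\bmod n}$. Then \[ F(U_n;f_n,g_n;v_j)=\sum_{q=1}^{n}\Big(f_n(v_j)\prod_{k=0}^{q-2}g_n(v_k^1,v_k^2)f_n(v_k^2)\Big(1+\sum_{s=0}^{n-q-1}\prod_{k=0}^{s}g_n(v_k^3,v_k^4)f_n(v_k^4)\Big)\Big), \] with the conventions that an empty product equals $1$ and an empty sum equals $0$.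
   Context: A subtree of a graph $G$ is a nonempty subgraph of $G$ that is a tree (single vertices count as subtrees). For a graph $G$ with vertex-weight function $f:V(G)\to\Re$ and edge-weight function $g:E(G)\to\Re$, the weight of a subtree $T$ is $\omega(T)=\prod_{v\in V(T)}f(v)\prod_{e\in E(T)}g(e)$. For a vertex $v$, $F(G;f,g;v)=\sum\omega(T)$, the sum over all subtrees $T$ of $G$ containing $v$. -}

module Defs where

open import Level using (Level)
open import Data.Bool using (Bool; true; false; if_then_else_)
open import Data.Nat using (ℕ; zero; suc; _+_; _∸_; _≤_; NonZero)
open import Data.Nat.DivMod using (_mod_)
open import Data.Fin using (Fin; toℕ)
open import Data.Vec using (Vec; lookup)
open import Data.List using (List; []; _∷_; foldr; map; allFin)
open import Data.List.Membership.Propositional using (_∈_)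
open import Data.List.Relation.Unary.Unique.Propositional using (Unique)
open import Data.Product using (_×_; _,_; proj₁; proj₂; ∃; Σ)
open import Data.Sum using (_⊎_)
open import Data.Empty using (⊥)
open import Function using (Injective)
open import Function.Bundles using (_⇔_)
open import Relation.Nullary using (¬_)
open import Relation.Binary.PropositionalEquality using (_≡_)
open import Algebra.Bundles using (CommutativeRing)

record Graph : Set where
  field
    nv   : ℕ
    ne   : ℕ
    ends : Fin ne → Fin nv × Fin nv
open Graph public

Joins : (G : Graph) → Fin (ne G) → Fin (nv G) → Fin (nv G) → Set
Joins G e a b = ends G e ≡ (a , b) ⊎ ends G e ≡ (b , a)

-- A subgraph is given by a vertex subset and an edge subset
-- (Boolean characteristic vectors, so ≡ is extensional).
record Subgraph (G : Graph) : Set where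
  constructor mkSub
  field
    vs : Vec Bool (nv G)
    es : Vec Bool (ne G)
open Subgraph public

module _ {G : Graph} (S : Subgraph G) where

  InV : Fin (nv G) → Set
  InV v = lookup (vs S) v ≡ true

  InE : Fin (ne G) → Set
  InE e = lookup (es S) e ≡ true

  IsSubgraph : Set
  IsSubgraph = ∀ e → InE e → InV (proj₁ (ends G e)) × InV (proj₂ (ends G e))

  Nonempty : Set
  Nonempty = ∃ λ v → InV v

  data Walk : Fin (nv G) → Fin (nv G) → Set where
    stop : ∀ {u} → InV u → Walk u u
    step : ∀ {u x w} (e : Fin (ne G)) → InE e → Joins G e u x →
           Walk x w → Walk u w

  Connected : Set
  Connected = ∀ u w → InV u → InV w → Walk u w

  record Cycle : Set where
    field
      len      : ℕ
      xs       : Fin (suc len) → Fin (nv G)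
      eds      : Fin (suc len) → Fin (ne G)
      xs-inj   : Injective _≡_ _≡_ xs
      eds-inj  : Injective _≡_ _≡_ eds
      eds-in   : ∀ i → InE (eds i)
      eds-join : ∀ i → Joins G (eds i) (xs i) (xs ((suc (toℕ i)) mod (suc len)))

  Acyclic : Set
  Acyclic = ¬ Cycle

  IsTree : Set
  IsTree = Connected × Acyclic

  IsSubtree : Set
  IsSubtree = IsSubgraph × Nonempty × IsTree

SubtreeContaining : (G : Graph) → Fin (nv G) → Subgraph G → Set
SubtreeContaining G v S = IsSubtree S × InV S v

EnumeratesSubtrees : (G : Graph) → Fin (nv G) → List (Subgraph G) → Set
EnumeratesSubtrees G v L = Unique L × (∀ S → (S ∈ L) ⇔ SubtreeContaining G v S)

module _ {c ℓ : Level} (R : CommutativeRing c ℓ) where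
  open CommutativeRing R renaming (_+_ to _⊕_; _*_ to _⊛_)

  ∏List : List Carrier → Carrier
  ∏List = foldr _⊛_ 1#

  ∑List : List Carrier → Carrier
  ∑List = foldr _⊕_ 0#

  ∑< : ℕ → (ℕ → Carrier) → Carrier
  ∑< zero    h = 0#
  ∑< (suc k) h = ∑< k h ⊕ h k

  ∏< : ℕ → (ℕ → Carrier) → Carrier
  ∏< zero    h = 1#
  ∏< (suc k) h = ∏< k h ⊛ h k

  ω : (G : Graph) → (Fin (nv G) → Carrier) → (Fin (ne G) → Carrier) →
      Subgraph G → Carrier
  ω G f g S =
    ∏List (map (λ v → if lookup (vs S) v then f v else 1#) (allFin (nv G))) ⊛
    ∏List (map (λ e → if lookup (es S) e then g e else 1#) (allFin (ne G)))

  F-along : (G : Graph) → (Fin (nv G) → Carrier) → (Fin (ne G) → Carrier) →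
            List (Subgraph G) → Carrier
  F-along G f g L = ∑List (map (ω G f g) L)

-- The cycle U_n.  Vertex v_m (m any integer ≥ 0) is Fin-index m mod n,
-- so v_n = v_0 is index 0.  Edge (v_i , v_{i+1}) is Fin-index i mod n.

idx : (n : ℕ) .{{_ : NonZero n}} → ℕ → Fin n
idx n m = m mod n

U : (n : ℕ) .{{_ : NonZero n}} → Graph
U n = record { nv = n ; ne = n ; ends = λ e → (e , idx n (suc (toℕ e))) }

module _ {c ℓ : Level} (R : CommutativeRing c ℓ) where
  open CommutativeRing R renaming (_+_ to _⊕_; _*_ to _⊛_)

  RHS : (n : ℕ) .{{_ : NonZero n}} → (Fin n → Carrier) → (Fin n → Carrier) →
        Fin n → Carrier
  RHS n f g j = ∑< R n λ i → let q = suc i in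
      (f (idx n J) ⊛ ∏< R (q ∸ 1) (λ k →
          g (idx n (J + k)) ⊛ f (idx n (J + k + 1))))
      ⊛ (1# ⊕ ∑< R (n ∸ q) (λ s → ∏< R (suc s) (λ k →
          -- g(v_k^3 , v_k^4) f(v_k^4); the edge between v_{j-k} and
          -- v_{j-k-1} is (v_{j-k-1}, v_{j-k}), of index (n+j-k-1) mod n
          g (idx n (n + J ∸ k ∸ 1)) ⊛ f (idx n (n + J ∸ k ∸ 1)))))
    where J = toℕ j

-- A subtree of the cycle U_n cannot contain all n edges, so it is a path; if it
-- contains v_j it is the path v_{j-b}, …, v_j, …, v_{j+t} with b + t < n, where t and b
-- count the consecutive edges present on either side of v_j, and distinct (t, b) give
-- distinct paths. The weight of that path is f(v_j) times the forward factors k < t and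
-- the backward factors k < b. Grouping by q = t + 1 and summing over b < n - t gives
-- the q-th summand: the term b = 0 is the 1, and b = s + 1 is the s-th inner product.

module Submission where

open import Defs
open import Level using (Level)
open import Data.Bool using (Bool; true; false; if_then_else_) renaming (_≟_ to _≟ᵇ_)
open import Data.Nat using (ℕ; zero; suc; _+_; _∸_; _≤_; _<_; _≤?_; _<?_; s≤s; z≤n; NonZero; >-nonZero⁻¹; _%_)
import Data.Nat.Properties as ℕₚ
open ℕₚ using (n<1+n; ≤-<-trans; <-cmp; m∸n+n≡m; m∸[m∸n]≡n; m≤n⇒m<n∨m≡n; ≮⇒≥; ≤-pred; m<n⇒m<1+n; m<1+n⇒m<n∨m≡n; <⇒≤; m+[n∸m]≡n; ≤-refl; ≤-trans; ≰⇒>; <-≤-trans; <⇒≱; 1+n≢n)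
open import Data.Nat.DivMod using (_mod_; %-distribˡ-+; m%n%n≡m%n; [m+n]%n≡m%n; m<n⇒m%n≡m; m%n<n; n%n≡0)
open import Data.Fin using (Fin; toℕ; fromℕ; inject₁) renaming (zero to fzero; suc to fsuc)
open import Data.Fin.Properties using (toℕ-injective; toℕ<n; toℕ-fromℕ<; toℕ-fromℕ; toℕ-inject₁)
import Data.Vec as Vec
open Vec using () renaming ([] to []ᵛ; _∷_ to _∷ᵛ_)
open import Data.Vec.Properties using (lookup∘tabulate; tabulate∘lookup; tabulate-cong)
open import Data.List using (List; []; _∷_; _++_; [_]; map; tabulate; allFin)
open import Data.List.Membership.Propositional using (_∈_)
open import Data.List.Membership.Propositional.Properties using (∈-++⁻; ∈-++⁺ˡ; ∈-++⁺ʳ)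
open import Data.List.Relation.Unary.Unique.Propositional using (Unique)
open import Data.List.Relation.Unary.Unique.Propositional.Properties using (++⁺)
open import Data.List.Relation.Unary.AllPairs using ([]; _∷_)
import Data.List.Relation.Unary.All as All
open import Data.List.Relation.Unary.Any using (here)
open import Data.List.Relation.Binary.Permutation.Propositional using (_↭_; ↭⇒↭ₛ′)
open import Data.List.Relation.Binary.Permutation.Propositional.Properties using (map⁺)
open import Data.List.Membership.Propositional.Properties.WithK using (unique∧set⇒bag)
open import Data.List.Relation.Binary.BagAndSetEquality using (∼bag⇒↭)
open import Data.Product using (_×_; _,_; proj₁; proj₂; ∃; ∃₂)
open import Data.Sum using (_⊎_; inj₁; inj₂; [_,_]′)
open import Data.Empty using (⊥; ⊥-elim)
open import Function using (_∘_)
open import Function.Bundles using (_⇔_; mk⇔)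
open import Function.Properties.Equivalence using () renaming (trans to ⇔-trans; sym to ⇔-sym)
open import Relation.Nullary using (¬_; Dec; does; yes; no)
open import Relation.Binary.Definitions using (tri<; tri≈; tri>)
open import Relation.Nullary.Decidable using (dec-true; dec-false)
open import Algebra.Bundles using (CommutativeRing)
open import Relation.Binary.PropositionalEquality as ≡ using (_≡_)

<∸⇒+< : ∀ {b t n} → t ≤ n → b < n ∸ t → b + t < n
<∸⇒+< {b} {t} t≤n b<n∸t = ≡.subst (b + t <_) (m∸n+n≡m t≤n) (ℕₚ.+-monoˡ-< t b<n∸t)

b∸[1+b∸1+i]≡i : ∀ {b i} → i < b → b ∸ suc (b ∸ suc i) ≡ i
b∸[1+b∸1+i]≡i {b} i<b = ≡.trans (≡.cong (b ∸_) (≡.sym (ℕₚ.+-∸-assoc 1 i<b))) (m∸[m∸n]≡n (<⇒≤ i<b))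

m+1+k≡m+k+1 : ∀ m k → m + suc k ≡ m + k + 1
m+1+k≡m+k+1 m k = ≡.trans (ℕₚ.+-suc m k) (ℕₚ.+-comm 1 (m + k))

m+[n∸1+k]≡n+m∸k∸1 : ∀ m {n k} → k < n → m + (n ∸ suc k) ≡ n + m ∸ k ∸ 1
m+[n∸1+k]≡n+m∸k∸1 m {n} {k} k<n = begin
  m + (n ∸ suc k)   ≡⟨ ℕₚ.+-∸-assoc m k<n ⟨
  m + n ∸ suc k     ≡⟨ ≡.cong (_∸ suc k) (ℕₚ.+-comm m n) ⟩
  n + m ∸ suc k     ≡⟨ ≡.cong (n + m ∸_) (ℕₚ.+-comm 1 k) ⟩
  n + m ∸ (k + 1)   ≡⟨ ℕₚ.∸-+-assoc (n + m) k 1 ⟨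
  n + m ∸ k ∸ 1     ∎
  where open ≡.≡-Reasoning

least-counterexample : ∀ {P : ℕ → Set} → (∀ k → Dec (P k)) → ∀ N →
  (∀ {k} → k < N → P k) ⊎ (∃ λ t → t < N × (∀ {k} → k < t → P k) × ¬ P t)
least-counterexample P? zero = inj₁ (λ ())
least-counterexample {P} P? (suc N) with least-counterexample P? N
... | inj₂ (t , t<N , below , ¬Pt) = inj₂ (t , m<n⇒m<1+n t<N , below , ¬Pt)
... | inj₁ below with P? N
...   | no ¬PN = inj₂ (N , n<1+n N , below , ¬PN)
...   | yes PN = inj₁ λ k<1+N → [ below , (λ k≡N → ≡.subst P (≡.sym k≡N) PN) ]′ (m<1+n⇒m<n∨m≡n k<1+N)

argmin : ∀ k (f : Fin (suc k) → ℕ) → ∃ λ i → ∀ i′ → f i ≤ f i′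
argmin zero    f = fzero , λ { fzero → ≤-refl }
argmin (suc k) f with argmin k (λ i → f (fsuc i))
... | i , min with f fzero ≤? f (fsuc i)
...   | yes f0≤ = fzero , λ { fzero → ≤-refl ; (fsuc i′) → ≤-trans f0≤ (min i′) }
...   | no  f0≰ = fsuc i , λ { fzero → <⇒≤ (≰⇒> f0≰) ; (fsuc i′) → min i′ }

prev : ∀ {k} → Fin (suc k) → Fin (suc k)
prev {k} fzero = fromℕ k
prev (fsuc i)  = inject₁ i

suc-prev : ∀ {k} (i : Fin (suc k)) → (suc (toℕ (prev i))) mod (suc k) ≡ i
suc-prev {k} fzero    = toℕ-injective (≡.trans (toℕ-fromℕ< _)
  (≡.trans (≡.cong (λ z → suc z % suc k) (toℕ-fromℕ k)) (n%n≡0 (suc k))))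
suc-prev {k} (fsuc i) = toℕ-injective (≡.trans (toℕ-fromℕ< _)
  (≡.trans (≡.cong (λ z → suc z % suc k) (toℕ-inject₁ i)) (m<n⇒m%n≡m (s≤s (toℕ<n i)))))

does-true⇒ : ∀ {P : Set} (p? : Dec P) → does p? ≡ true → P
does-true⇒ (yes p) _ = p

does≡ : ∀ {P : Set} (b : Bool) (p? : Dec P) → (b ≡ true → P) → (P → b ≡ true) → b ≡ does p?
does≡ true  (yes p) b⇒p p⇒b = ≡.refl
does≡ true  (no ¬p) b⇒p p⇒b = ⊥-elim (¬p (b⇒p ≡.refl))
does≡ false (yes p) b⇒p p⇒b = p⇒b p
does≡ false (no ¬p) b⇒p p⇒b = ≡.refl

unique-⇔⇒↭ : ∀ {A : Set} {xs ys : List A} → Unique xs → Unique ys →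
  (∀ {z} → z ∈ xs ⇔ z ∈ ys) → xs ↭ ys
unique-⇔⇒↭ uxs uys xs⇔ys = ∼bag⇒↭ (unique∧set⇒bag uxs uys xs⇔ys)

module _ {A : Set} where

  concat< : ℕ → (ℕ → List A) → List A
  concat< zero    h = []
  concat< (suc k) h = concat< k h ++ h k

  ∈-concat<⁻ : ∀ k h {z} → z ∈ concat< k h → ∃ λ i → i < k × z ∈ h i
  ∈-concat<⁻ (suc k) h z∈ with ∈-++⁻ (concat< k h) z∈
  ... | inj₁ z∈ʳ = let (i , i<k , z∈hi) = ∈-concat<⁻ k h z∈ʳ in i , m<n⇒m<1+n i<k , z∈hi
  ... | inj₂ z∈hk = k , n<1+n k , z∈hk

  ∈-concat<⁺ : ∀ k h {z i} → i < k → z ∈ h i → z ∈ concat< k h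
  ∈-concat<⁺ (suc k) h i<1+k z∈hi with m<1+n⇒m<n∨m≡n i<1+k
  ... | inj₁ i<k    = ∈-++⁺ˡ (∈-concat<⁺ k h i<k z∈hi)
  ... | inj₂ ≡.refl = ∈-++⁺ʳ (concat< k h) z∈hi

  concat<-unique : ∀ k h → (∀ i → i < k → Unique (h i)) →
    (∀ {i i′ z} → i < i′ → i′ < k → z ∈ h i → z ∈ h i′ → ⊥) → Unique (concat< k h)
  concat<-unique zero    h uh disjoint = []
  concat<-unique (suc k) h uh disjoint = ++⁺
    (concat<-unique k h (λ i i<k → uh i (m<n⇒m<1+n i<k)) (λ i<i′ i′<k → disjoint i<i′ (m<n⇒m<1+n i′<k)))
    (uh k (n<1+n k))
    (λ (z∈ʳ , z∈hk) → let (i , i<k , z∈hi) = ∈-concat<⁻ k h z∈ʳ in disjoint i<k (n<1+n k) z∈hi z∈hk)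

module _ {c ℓ : Level} (R : CommutativeRing c ℓ) where
  open CommutativeRing R renaming (_+_ to _⊕_; _*_ to _⊛_)
  open import Relation.Binary.Reasoning.Setoid setoid
  open import Data.List.Relation.Binary.Permutation.Setoid.Properties setoid
    using (foldr-commMonoid)
  open import Algebra.Properties.CommutativeSemigroup *-commutativeSemigroup
    using (interchange)

  private
    ∏ : ℕ → (ℕ → Carrier) → Carrier
    ∏ = ∏< R
    ∑ : ℕ → (ℕ → Carrier) → Carrier
    ∑ = ∑< R

  ∏<-cong : ∀ k {h h′} → (∀ i → i < k → h i ≈ h′ i) → ∏ k h ≈ ∏ k h′
  ∏<-cong zero    h≈h′ = refl
  ∏<-cong (suc k) h≈h′ = *-cong (∏<-cong k (λ i i<k → h≈h′ i (m<n⇒m<1+n i<k))) (h≈h′ k (n<1+n k))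

  ∑<-cong : ∀ k {h h′} → (∀ i → i < k → h i ≈ h′ i) → ∑ k h ≈ ∑ k h′
  ∑<-cong zero    h≈h′ = refl
  ∑<-cong (suc k) h≈h′ = +-cong (∑<-cong k (λ i i<k → h≈h′ i (m<n⇒m<1+n i<k))) (h≈h′ k (n<1+n k))

  ∏<-split : ∀ a b h → ∏ (b + a) h ≈ ∏ a h ⊛ ∏ b (λ i → h (a + i))
  ∏<-split a zero    h = sym (*-identityʳ _)
  ∏<-split a (suc b) h = begin
    ∏ (b + a) h ⊛ h (b + a)                         ≈⟨ *-cong (∏<-split a b h) (reflexive (≡.cong h (ℕₚ.+-comm b a))) ⟩
    (∏ a h ⊛ ∏ b (λ i → h (a + i))) ⊛ h (a + b)     ≈⟨ *-assoc _ _ _ ⟩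
    ∏ a h ⊛ (∏ b (λ i → h (a + i)) ⊛ h (a + b))     ∎

  ∏<-suc : ∀ k h → ∏ (suc k) h ≈ h 0 ⊛ ∏ k (λ i → h (suc i))
  ∏<-suc zero    h = trans (*-identityˡ _) (sym (*-identityʳ _))
  ∏<-suc (suc k) h = trans (*-congʳ (∏<-suc k h)) (*-assoc _ _ _)

  ∑<-suc : ∀ k h → ∑ (suc k) h ≈ h 0 ⊕ ∑ k (λ i → h (suc i))
  ∑<-suc zero    h = trans (+-identityˡ _) (sym (+-identityʳ _))
  ∑<-suc (suc k) h = trans (+-congʳ (∑<-suc k h)) (+-assoc _ _ _)

  ∏<-identity : ∀ k h → (∀ i → i < k → h i ≈ 1#) → ∏ k h ≈ 1#
  ∏<-identity k h h≈1 = trans (∏<-cong k h≈1) (ones k)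
    where
    ones : ∀ k → ∏ k (λ _ → 1#) ≈ 1#
    ones zero    = refl
    ones (suc k) = trans (*-identityʳ _) (ones k)

  ∏<-* : ∀ k h h′ → ∏ k (λ i → h i ⊛ h′ i) ≈ ∏ k h ⊛ ∏ k h′
  ∏<-* zero    h h′ = sym (*-identityˡ _)
  ∏<-* (suc k) h h′ = begin
    ∏ k (λ i → h i ⊛ h′ i) ⊛ (h k ⊛ h′ k) ≈⟨ *-congʳ (∏<-* k h h′) ⟩
    (∏ k h ⊛ ∏ k h′) ⊛ (h k ⊛ h′ k)       ≈⟨ interchange _ _ _ _ ⟩
    (∏ k h ⊛ h k) ⊛ (∏ k h′ ⊛ h′ k)       ∎

  ∏<-reverse : ∀ k h → ∏ k h ≈ ∏ k (λ i → h (k ∸ suc i))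
  ∏<-reverse zero    h = refl
  ∏<-reverse (suc k) h = begin
    ∏ k h ⊛ h k                            ≈⟨ *-comm _ _ ⟩
    h k ⊛ ∏ k h                            ≈⟨ *-congˡ (∏<-reverse k h) ⟩
    h k ⊛ ∏ k (λ i → h (k ∸ suc i))        ≈⟨ sym (∏<-suc k (λ i → h (suc k ∸ suc i))) ⟩
    ∏ (suc k) (λ i → h (suc k ∸ suc i))    ∎

  *-distribˡ-∑< : ∀ x k h → x ⊛ ∑ k h ≈ ∑ k (λ i → x ⊛ h i)
  *-distribˡ-∑< x zero    h = zeroʳ x
  *-distribˡ-∑< x (suc k) h = trans (distribˡ x _ _) (+-congʳ (*-distribˡ-∑< x k h))

  ∏List-map-tabulate : ∀ {A : Set} k (a : Fin k → A) (h : A → Carrier) (H : ℕ → Carrier) →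
    (∀ i → H (toℕ i) ≈ h (a i)) → ∏List R (map h (tabulate a)) ≈ ∏ k H
  ∏List-map-tabulate zero    a h H H≈h = refl
  ∏List-map-tabulate (suc k) a h H H≈h = begin
    h (a fzero) ⊛ ∏List R (map h (tabulate (λ i → a (fsuc i))))
      ≈⟨ *-cong (sym (H≈h fzero)) (∏List-map-tabulate k (λ i → a (fsuc i)) h (λ i → H (suc i)) (λ i → H≈h (fsuc i))) ⟩
    H 0 ⊛ ∏ k (λ i → H (suc i))
      ≈⟨ sym (∏<-suc k H) ⟩
    ∏ (suc k) H ∎

  ∏<-rotate : ∀ n h a → a ≤ n → (∀ i → h (n + i) ≈ h i) → ∏ n h ≈ ∏ n (λ i → h (a + i))
  ∏<-rotate n h a a≤n periodic = begin
    ∏ n h                                                ≡⟨ ≡.cong (λ k → ∏ k h) (m∸n+n≡m a≤n) ⟨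
    ∏ (n ∸ a + a) h                                      ≈⟨ ∏<-split a (n ∸ a) h ⟩
    ∏ a h ⊛ ∏ (n ∸ a) (λ i → h (a + i))                  ≈⟨ *-comm _ _ ⟩
    ∏ (n ∸ a) (λ i → h (a + i)) ⊛ ∏ a h                  ≈⟨ *-congˡ (∏<-cong a (λ i _ → sym (wrap i))) ⟩
    ∏ (n ∸ a) (λ i → h (a + i)) ⊛ ∏ a (λ i → h (a + (n ∸ a + i))) ≈⟨ ∏<-split (n ∸ a) a (λ i → h (a + i)) ⟨
    ∏ (a + (n ∸ a)) (λ i → h (a + i))                    ≡⟨ ≡.cong (λ k → ∏ k (λ i → h (a + i))) (m+[n∸m]≡n a≤n) ⟩
    ∏ n (λ i → h (a + i))                                ∎
    where
    wrap : ∀ i → h (a + (n ∸ a + i)) ≈ h i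
    wrap i = trans (reflexive (≡.cong h (≡.trans (≡.sym (ℕₚ.+-assoc a (n ∸ a) i))
                                                  (≡.cong (_+ i) (m+[n∸m]≡n a≤n)))))
                   (periodic i)

  -- The weight of a path v_0, …, v_{b+t} (vertex weights F, edge i joining v_i and v_{i+1}
  -- has weight G i), grouped outward from v_b.
  ∏<-path-split : ∀ b t (F G : ℕ → Carrier) →
    ∏ (suc (b + t)) F ⊛ ∏ (b + t) G ≈
    (F b ⊛ ∏ t (λ i → G (b + i) ⊛ F (b + suc i))) ⊛ ∏ b (λ i → G i ⊛ F i)
  ∏<-path-split b t F G = begin
    ∏ (suc (b + t)) F ⊛ ∏ (b + t) G
      ≡⟨ ≡.cong₂ (λ x y → ∏ (suc x) F ⊛ ∏ y G) (ℕₚ.+-comm b t) (ℕₚ.+-comm b t) ⟩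
    ∏ (suc t + b) F ⊛ ∏ (t + b) G
      ≈⟨ *-cong (∏<-split b (suc t) F) (∏<-split b t G) ⟩
    (∏ b F ⊛ ∏ (suc t) (λ i → F (b + i))) ⊛ (∏ b G ⊛ ∏ t (λ i → G (b + i)))
      ≈⟨ *-congʳ (*-congˡ (∏<-suc t (λ i → F (b + i)))) ⟩
    (∏ b F ⊛ (F (b + 0) ⊛ ∏ t (λ i → F (b + suc i)))) ⊛ (∏ b G ⊛ ∏ t (λ i → G (b + i)))
      ≈⟨ rearrange _ _ _ _ _ ⟩
    (F (b + 0) ⊛ (∏ t (λ i → G (b + i)) ⊛ ∏ t (λ i → F (b + suc i)))) ⊛ (∏ b G ⊛ ∏ b F)
      ≈⟨ *-cong (*-cong (reflexive (≡.cong F (ℕₚ.+-identityʳ b))) (sym (∏<-* t _ _))) (sym (∏<-* b G F)) ⟩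
    (F b ⊛ ∏ t (λ i → G (b + i) ⊛ F (b + suc i))) ⊛ ∏ b (λ i → G i ⊛ F i)
      ∎
    where
    rearrange : ∀ a b c d e → (a ⊛ (b ⊛ c)) ⊛ (d ⊛ e) ≈ (b ⊛ (e ⊛ c)) ⊛ (d ⊛ a)
    rearrange a b c d e = prove 5 ((A ∙ (B ∙ C)) ∙ (D ∙ E)) ((B ∙ (E ∙ C)) ∙ (D ∙ A)) (a ∷ᵛ b ∷ᵛ c ∷ᵛ d ∷ᵛ e ∷ᵛ []ᵛ)
      where
      open import Algebra.Solver.CommutativeMonoid *-commutativeMonoid renaming (_⊕_ to _∙_)
      A = var fzero
      B = var (fsuc fzero)
      C = var (fsuc (fsuc fzero))
      D = var (fsuc (fsuc (fsuc fzero)))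
      E = var (fsuc (fsuc (fsuc (fsuc fzero))))

  module _ {A : Set} (w : A → Carrier) where

    ∑List-map-++ : ∀ xs ys → ∑List R (map w (xs ++ ys)) ≈ ∑List R (map w xs) ⊕ ∑List R (map w ys)
    ∑List-map-++ []       ys = sym (+-identityˡ _)
    ∑List-map-++ (x ∷ xs) ys = trans (+-congˡ (∑List-map-++ xs ys)) (sym (+-assoc _ _ _))

    ∑List-map-↭ : ∀ {xs ys} → xs ↭ ys → ∑List R (map w xs) ≈ ∑List R (map w ys)
    ∑List-map-↭ p = foldr-commMonoid +-isCommutativeMonoid (↭⇒↭ₛ′ isEquivalence (map⁺ w p))

    ∑List-map-concat< : ∀ k h → ∑List R (map w (concat< k h)) ≈ ∑ k (λ i → ∑List R (map w (h i)))
    ∑List-map-concat< zero    h = refl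
    ∑List-map-concat< (suc k) h = trans (∑List-map-++ (concat< k h) (h k)) (+-congʳ (∑List-map-concat< k h))

module _ {G : Graph} {S : Subgraph G} where

  _++ʷ_ : ∀ {u x w} → Walk S u x → Walk S x w → Walk S u w
  stop _          ++ʷ w′ = w′
  step e e∈ j w   ++ʷ w′ = step e e∈ j (w ++ʷ w′)

InE? : ∀ {G : Graph} (S : Subgraph G) e → Dec (InE S e)
InE? S e = Vec.lookup (es S) e ≟ᵇ true

enumerations-↭ : ∀ {G v L L′} → EnumeratesSubtrees G v L → EnumeratesSubtrees G v L′ → L ↭ L′
enumerations-↭ (uL , L⇔) (uL′ , L′⇔) = unique-⇔⇒↭ uL uL′ (λ {S} → ⇔-trans (L⇔ S) (⇔-sym (L′⇔ S)))

module Cyclic (n : ℕ) .{{_ : NonZero n}} where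

  infixl 6 _⊞_

  _⊞_ : Fin n → ℕ → Fin n
  s ⊞ i = idx n (toℕ s + i)

  next : Fin n → Fin n
  next v = idx n (suc (toℕ v))

  offset : Fin n → Fin n → ℕ
  offset s v = (toℕ v + (n ∸ toℕ s)) % n

  offset<n : ∀ s v → offset s v < n
  offset<n s v = m%n<n _ n

  toℕ-idx : ∀ x → toℕ (idx n x) ≡ x % n
  toℕ-idx x = toℕ-fromℕ< (m%n<n x n)

  idx-cong-% : ∀ {x y} → x % n ≡ y % n → idx n x ≡ idx n y
  idx-cong-% {x} {y} eq = toℕ-injective (≡.trans (toℕ-idx x) (≡.trans eq (≡.sym (toℕ-idx y))))

  idx-toℕ : ∀ v → idx n (toℕ v) ≡ v
  idx-toℕ v = toℕ-injective (≡.trans (toℕ-idx (toℕ v)) (m<n⇒m%n≡m (toℕ<n v)))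

  idx-+n : ∀ x → idx n (x + n) ≡ idx n x
  idx-+n x = idx-cong-% ([m+n]%n≡m%n x n)

  %-+ˡ : ∀ x y → (x % n + y) % n ≡ (x + y) % n
  %-+ˡ x y = begin
    (x % n + y) % n          ≡⟨ %-distribˡ-+ (x % n) y n ⟩
    (x % n % n + y % n) % n  ≡⟨ ≡.cong (λ z → (z + y % n) % n) (m%n%n≡m%n x n) ⟩
    (x % n + y % n) % n      ≡⟨ %-distribˡ-+ x y n ⟨
    (x + y) % n              ∎
    where open ≡.≡-Reasoning

  %-+ʳ : ∀ x y → (x + y % n) % n ≡ (x + y) % n
  %-+ʳ x y = ≡.trans (≡.cong (_% n) (ℕₚ.+-comm x (y % n))) (≡.trans (%-+ˡ y x) (≡.cong (_% n) (ℕₚ.+-comm y x)))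

  ⊞-assoc : ∀ s a i → s ⊞ a ⊞ i ≡ s ⊞ (a + i)
  ⊞-assoc s a i = idx-cong-% (≡.trans (%-+ˡ-toℕ) (≡.cong (_% n) (ℕₚ.+-assoc (toℕ s) a i)))
    where
    %-+ˡ-toℕ : (toℕ (s ⊞ a) + i) % n ≡ (toℕ s + a + i) % n
    %-+ˡ-toℕ = ≡.trans (≡.cong (λ z → (z + i) % n) (toℕ-idx _)) (%-+ˡ _ i)

  ⊞-0 : ∀ s → s ⊞ 0 ≡ s
  ⊞-0 s = ≡.trans (≡.cong (idx n) (ℕₚ.+-identityʳ (toℕ s))) (idx-toℕ s)

  ⊞-+n : ∀ s i → s ⊞ (i + n) ≡ s ⊞ i
  ⊞-+n s i = ≡.trans (≡.cong (idx n) (≡.sym (ℕₚ.+-assoc (toℕ s) i n))) (idx-+n (toℕ s + i))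

  next-⊞ : ∀ s i → next (s ⊞ i) ≡ s ⊞ suc i
  next-⊞ s i = idx-cong-% (begin
    suc (toℕ (s ⊞ i)) % n     ≡⟨ ≡.cong (λ z → suc z % n) (toℕ-idx _) ⟩
    (1 + (toℕ s + i) % n) % n ≡⟨ %-+ʳ 1 (toℕ s + i) ⟩
    suc (toℕ s + i) % n       ≡⟨ ≡.cong (_% n) (ℕₚ.+-suc (toℕ s) i) ⟨
    (toℕ s + suc i) % n       ∎)
    where open ≡.≡-Reasoning

  private
    s+x+[n∸s]≡x+n : ∀ (s : Fin n) x → toℕ s + x + (n ∸ toℕ s) ≡ x + n
    s+x+[n∸s]≡x+n s x = begin
      toℕ s + x + (n ∸ toℕ s)   ≡⟨ ≡.cong (_+ (n ∸ toℕ s)) (ℕₚ.+-comm (toℕ s) x) ⟩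
      x + toℕ s + (n ∸ toℕ s)   ≡⟨ ℕₚ.+-assoc x (toℕ s) _ ⟩
      x + (toℕ s + (n ∸ toℕ s)) ≡⟨ ≡.cong (x +_) (m+[n∸m]≡n (<⇒≤ (toℕ<n s))) ⟩
      x + n                     ∎
      where open ≡.≡-Reasoning

  offset-⊞ : ∀ s i → offset s (s ⊞ i) ≡ i % n
  offset-⊞ s i = begin
    (toℕ (s ⊞ i) + (n ∸ toℕ s)) % n     ≡⟨ ≡.cong (λ z → (z + (n ∸ toℕ s)) % n) (toℕ-idx (toℕ s + i)) ⟩
    ((toℕ s + i) % n + (n ∸ toℕ s)) % n ≡⟨ %-+ˡ (toℕ s + i) (n ∸ toℕ s) ⟩
    (toℕ s + i + (n ∸ toℕ s)) % n       ≡⟨ ≡.cong (_% n) (s+x+[n∸s]≡x+n s i) ⟩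
    (i + n) % n                         ≡⟨ [m+n]%n≡m%n i n ⟩
    i % n                               ∎
    where open ≡.≡-Reasoning

  ⊞-offset : ∀ s v → s ⊞ offset s v ≡ v
  ⊞-offset s v = toℕ-injective (begin
    toℕ (s ⊞ offset s v)                     ≡⟨ toℕ-idx _ ⟩
    (toℕ s + (toℕ v + (n ∸ toℕ s)) % n) % n  ≡⟨ %-+ʳ (toℕ s) _ ⟩
    (toℕ s + (toℕ v + (n ∸ toℕ s))) % n      ≡⟨ ≡.cong (_% n) (ℕₚ.+-assoc (toℕ s) (toℕ v) _) ⟨
    (toℕ s + toℕ v + (n ∸ toℕ s)) % n        ≡⟨ ≡.cong (_% n) (s+x+[n∸s]≡x+n s (toℕ v)) ⟩
    (toℕ v + n) % n                          ≡⟨ [m+n]%n≡m%n (toℕ v) n ⟩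
    toℕ v % n                                ≡⟨ m<n⇒m%n≡m (toℕ<n v) ⟩
    toℕ v                                    ∎)
    where open ≡.≡-Reasoning

  offset-⊞< : ∀ s {i} → i < n → offset s (s ⊞ i) ≡ i
  offset-⊞< s i<n = ≡.trans (offset-⊞ s _) (m<n⇒m%n≡m i<n)

  offset-self : ∀ s → offset s s ≡ 0
  offset-self s = ≡.trans (≡.cong (offset s) (≡.sym (⊞-0 s))) (offset-⊞< s (>-nonZero⁻¹ n))

  offset-injective : ∀ s {u v} → offset s u ≡ offset s v → u ≡ v
  offset-injective s {u} {v} eq = ≡.trans (≡.sym (⊞-offset s u)) (≡.trans (≡.cong (s ⊞_) eq) (⊞-offset s v))

  offset-next : ∀ s v → suc (offset s v) < n → offset s (next v) ≡ suc (offset s v)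
  offset-next s v 1+o<n = begin
    offset s (next v)                   ≡⟨ ≡.cong (λ z → offset s (next z)) (⊞-offset s v) ⟨
    offset s (next (s ⊞ offset s v))    ≡⟨ ≡.cong (offset s) (next-⊞ s (offset s v)) ⟩
    offset s (s ⊞ suc (offset s v))     ≡⟨ offset-⊞< s 1+o<n ⟩
    suc (offset s v)                    ∎
    where open ≡.≡-Reasoning

module Arcs (n : ℕ) .{{_ : NonZero n}} where
  open Cyclic n

  joins-U : ∀ {e a b} → Joins (U n) e a b → (a ≡ e × b ≡ next e) ⊎ (b ≡ e × a ≡ next e)
  joins-U (inj₁ ≡.refl) = inj₁ (≡.refl , ≡.refl)
  joins-U (inj₂ ≡.refl) = inj₂ (≡.refl , ≡.refl)

  arc : Fin n → ℕ → Subgraph (U n)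
  arc s m = mkSub (Vec.tabulate (λ v → does (offset s v <? m)))
                  (Vec.tabulate (λ e → does (suc (offset s e) <? m)))

  module _ (s : Fin n) (m : ℕ) where

    arc-vertex⁻ : ∀ {v} → InV (arc s m) v → offset s v < m
    arc-vertex⁻ {v} v∈ = does-true⇒ (offset s v <? m) (≡.trans (≡.sym (lookup∘tabulate _ v)) v∈)

    arc-vertex⁺ : ∀ {v} → offset s v < m → InV (arc s m) v
    arc-vertex⁺ {v} o<m = ≡.trans (lookup∘tabulate _ v) (dec-true (offset s v <? m) o<m)

    arc-edge⁻ : ∀ {e} → InE (arc s m) e → suc (offset s e) < m
    arc-edge⁻ {e} e∈ = does-true⇒ (suc (offset s e) <? m) (≡.trans (≡.sym (lookup∘tabulate _ e)) e∈)

    arc-edge⁺ : ∀ {e} → suc (offset s e) < m → InE (arc s m) e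
    arc-edge⁺ {e} o<m = ≡.trans (lookup∘tabulate _ e) (dec-true (suc (offset s e) <? m) o<m)

    arc-∌-⊞ : ∀ {i} → i < n → m ≤ suc i → ¬ InE (arc s m) (s ⊞ i)
    arc-∌-⊞ i<n m≤1+i e∈ = <⇒≱ (≡.subst (λ o → suc o < m) (offset-⊞< s i<n) (arc-edge⁻ e∈)) m≤1+i

  module _ (s : Fin n) (m : ℕ) (m≤n : m ≤ n) where

    arc-edge-offsets : ∀ {e a b} → InE (arc s m) e → Joins (U n) e a b →
      (offset s a ≡ offset s e × offset s b ≡ suc (offset s e)) ⊎
      (offset s b ≡ offset s e × offset s a ≡ suc (offset s e))
    arc-edge-offsets {e} e∈ e-joins with joins-U e-joins | offset-next s e (<-≤-trans (arc-edge⁻ s m e∈) m≤n)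
    ... | inj₁ (≡.refl , ≡.refl) | o′ = inj₁ (≡.refl , o′)
    ... | inj₂ (≡.refl , ≡.refl) | o′ = inj₂ (≡.refl , o′)

    arc-isSubgraph : IsSubgraph (arc s m)
    arc-isSubgraph e e∈ =
      arc-vertex⁺ s m (<⇒≤ (arc-edge⁻ s m e∈)) ,
      arc-vertex⁺ s m (≡.subst (_< m) (≡.sym (offset-next s e (<-≤-trans (arc-edge⁻ s m e∈) m≤n))) (arc-edge⁻ s m e∈))

    -- At a cycle vertex of least offset both incident cycle edges must be the
    -- edge leaving that vertex forwards, contradicting their distinctness.
    arc-acyclic : Acyclic (arc s m)
    arc-acyclic c = self-loop
      where
      open Cycle c
      o : Fin (suc len) → ℕ
      o i = offset s (xs i)
      i = proj₁ (argmin len o)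
      minimal = proj₂ (argmin len o)
      i⁺ = (suc (toℕ i)) mod (suc len)
      out : o i ≡ offset s (eds i)
      out with arc-edge-offsets (eds-in i) (eds-join i)
      ... | inj₁ (a , _) = a
      ... | inj₂ (b , a) = ⊥-elim (<⇒≱ (≡.subst₂ _<_ (≡.sym b) (≡.sym a) (n<1+n _)) (minimal i⁺))
      in′ : o i ≡ offset s (eds (prev i))
      in′ with arc-edge-offsets (eds-in (prev i)) (eds-join (prev i))
      ... | inj₁ (a , b) = ⊥-elim (<⇒≱ (≡.subst₂ _<_ (≡.sym a)
                              (≡.trans (≡.sym b) (≡.cong (λ z → o z) (suc-prev i))) (n<1+n _)) (minimal (prev i)))
      ... | inj₂ (b , _) = ≡.trans (≡.cong o (≡.sym (suc-prev i))) b
      i⁺≡i : i⁺ ≡ i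
      i⁺≡i = ≡.trans (≡.cong (λ z → (suc (toℕ z)) mod (suc len))
               (≡.sym (eds-inj (offset-injective s (≡.trans (≡.sym in′) out))))) (suc-prev i)
      self-loop : ⊥
      self-loop with arc-edge-offsets (eds-in i) (eds-join i)
      ... | inj₁ (a , b) = 1+n≢n (≡.trans (≡.sym b) (≡.trans (≡.cong o i⁺≡i) a))
      ... | inj₂ (b , a) = 1+n≢n (≡.trans (≡.sym a) (≡.trans (≡.cong o (≡.sym i⁺≡i)) b))

    arc-vertex-⊞ : ∀ {i} → i < m → InV (arc s m) (s ⊞ i)
    arc-vertex-⊞ i<m = arc-vertex⁺ s m (≡.subst (_< m) (≡.sym (offset-⊞< s (<-≤-trans i<m m≤n))) i<m)

    arc-edge-⊞ : ∀ {i} → suc i < m → InE (arc s m) (s ⊞ i)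
    arc-edge-⊞ 1+i<m = arc-edge⁺ s m
      (≡.subst (λ o → suc o < m) (≡.sym (offset-⊞< s (<-≤-trans (<⇒≤ 1+i<m) m≤n))) 1+i<m)

    walk-forward : ∀ {k} → suc k < m → Walk (arc s m) (s ⊞ k) (s ⊞ suc k)
    walk-forward {k} 1+k<m =
      step (s ⊞ k) (arc-edge-⊞ 1+k<m) (inj₁ (≡.cong (s ⊞ k ,_) (next-⊞ s k))) (stop (arc-vertex-⊞ 1+k<m))

    walk-backward : ∀ {k} → suc k < m → Walk (arc s m) (s ⊞ suc k) (s ⊞ k)
    walk-backward {k} 1+k<m =
      step (s ⊞ k) (arc-edge-⊞ 1+k<m) (inj₂ (≡.cong (s ⊞ k ,_) (next-⊞ s k))) (stop (arc-vertex-⊞ (<⇒≤ 1+k<m)))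

    walk-from-origin : ∀ d → d < m → Walk (arc s m) (s ⊞ 0) (s ⊞ d)
    walk-from-origin zero    0<m   = stop (arc-vertex-⊞ 0<m)
    walk-from-origin (suc d) 1+d<m = walk-from-origin d (<⇒≤ 1+d<m) ++ʷ walk-forward 1+d<m

    walk-to-origin : ∀ d → d < m → Walk (arc s m) (s ⊞ d) (s ⊞ 0)
    walk-to-origin zero    0<m   = stop (arc-vertex-⊞ 0<m)
    walk-to-origin (suc d) 1+d<m = walk-backward 1+d<m ++ʷ walk-to-origin d (<⇒≤ 1+d<m)

    arc-connected : Connected (arc s m)
    arc-connected u w u∈ w∈ = ≡.subst₂ (Walk (arc s m)) (⊞-offset s u) (⊞-offset s w)
      (walk-to-origin (offset s u) (arc-vertex⁻ s m u∈) ++ʷ walk-from-origin (offset s w) (arc-vertex⁻ s m w∈))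

    arc-isSubtree : 0 < m → IsSubtree (arc s m)
    arc-isSubtree 0<m =
      arc-isSubgraph , (s , arc-vertex⁺ s m (≡.subst (_< m) (≡.sym (offset-self s)) 0<m)) , arc-connected , arc-acyclic

  -- Edge s ⊞ i joins v_{s+i} and v_{s+i+1}; so s ⊞ (n ∸ 1) is the edge entering v_s.
  module _ {S : Subgraph (U n)} (sub : IsSubgraph S) (conn : Connected S)
           (s : Fin n) (k : ℕ) (k<n : k < n)
           (inner : ∀ {i} → i < k → InE S (s ⊞ i)) (¬last : ¬ InE S (s ⊞ k))
           (¬first : ¬ InE S (s ⊞ (n ∸ 1)))
           {u : Fin n} (u∈ : InV S u) (u≤k : offset s u ≤ k) where

    private
      ∈-at-offset : ∀ {e i} → InE S e → offset s e ≡ i → InE S (s ⊞ i)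
      ∈-at-offset {e} e∈ ≡.refl = ≡.subst (InE S) (≡.sym (⊞-offset s e)) e∈

      walk-stays : ∀ {v w} → Walk S v w → offset s v ≤ k → offset s w ≤ k
      walk-stays (stop _) v≤k = v≤k
      walk-stays (step e e∈ e-joins w) v≤k with joins-U e-joins
      ... | inj₁ (≡.refl , ≡.refl) with m≤n⇒m<n∨m≡n v≤k
      ...   | inj₁ e<k = walk-stays w (≡.subst (_≤ k) (≡.sym (offset-next s e (<-≤-trans (s≤s e<k) k<n))) e<k)
      ...   | inj₂ e≡k = ⊥-elim (¬last (∈-at-offset e∈ e≡k))
      walk-stays (step e e∈ e-joins w) v≤k | inj₂ (≡.refl , ≡.refl) with suc (offset s e) <? n
      ...   | yes 1+e<n = walk-stays w (<⇒≤ (≡.subst (_≤ k) (offset-next s e 1+e<n) v≤k))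
      ...   | no  1+e≮n = ⊥-elim (¬first (∈-at-offset e∈ e≡n-1))
        where
        e≡n-1 : offset s e ≡ n ∸ 1
        e≡n-1 = ≡.sym (ℕₚ.≤-antisym (ℕₚ.∸-monoˡ-≤ 1 (≮⇒≥ 1+e≮n)) (ℕₚ.<⇒≤pred (offset<n s e)))

      vertex⁻ : ∀ {v} → InV S v → offset s v ≤ k
      vertex⁻ {v} v∈ = walk-stays (conn u v u∈ v∈) u≤k

      vertex⁺ : ∀ {v} → offset s v ≤ k → InV S v
      vertex⁺ {v} v≤k = ≡.subst (InV S) (⊞-offset s v) (⊞∈ (offset s v) v≤k)
        where
        ⊞∈ : ∀ i → i ≤ k → InV S (s ⊞ i)
        ⊞∈ (suc i) 1+i≤k = ≡.subst (InV S) (next-⊞ s i) (proj₂ (sub (s ⊞ i) (inner 1+i≤k)))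
        ⊞∈ zero    _ with 0 <? k
        ... | yes 0<k = proj₁ (sub (s ⊞ 0) (inner 0<k))
        ... | no  0≮k = ≡.subst (InV S) (≡.cong (s ⊞_) u≡0) (≡.subst (InV S) (≡.sym (⊞-offset s u)) u∈)
          where
          u≡0 : offset s u ≡ 0
          u≡0 = ℕₚ.n≤0⇒n≡0 (≤-trans u≤k (≮⇒≥ 0≮k))

      edge⁻ : ∀ {e} → InE S e → offset s e < k
      edge⁻ {e} e∈ with m≤n⇒m<n∨m≡n (vertex⁻ (proj₁ (sub e e∈)))
      ... | inj₁ e<k = e<k
      ... | inj₂ e≡k = ⊥-elim (¬last (∈-at-offset e∈ e≡k))

      edge⁺ : ∀ {e} → offset s e < k → InE S e
      edge⁺ {e} e<k = ≡.subst (InE S) (⊞-offset s e) (inner e<k)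

    subgraph≡arc : S ≡ arc s (suc k)
    subgraph≡arc = ≡.cong₂ mkSub
      (≡.trans (≡.sym (tabulate∘lookup (vs S)))
        (tabulate-cong (λ v → does≡ _ (offset s v <? suc k) (s≤s ∘ vertex⁻) (vertex⁺ ∘ ≤-pred))))
      (≡.trans (≡.sym (tabulate∘lookup (es S)))
        (tabulate-cong (λ e → does≡ _ (suc (offset s e) <? suc k) (s≤s ∘ edge⁻) (edge⁺ ∘ ≤-pred))))

U-cycle : ∀ n .{{_ : NonZero n}} (S : Subgraph (U n)) → (∀ e → InE S e) → Cycle S
U-cycle (suc n) S all∈ = record
  { len = n ; xs = λ i → i ; eds = λ i → i ; xs-inj = λ eq → eq ; eds-inj = λ eq → eq
  ; eds-in = all∈ ; eds-join = λ i → inj₁ ≡.refl }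

module Around (n : ℕ) .{{_ : NonZero n}} (j : Fin n) where
  open Cyclic n
  open Arcs n

  origin : ℕ → Fin n
  origin b = j ⊞ (n ∸ b)

  -- the path v_{j-b}, …, v_j, …, v_{j+t}
  around : ℕ → ℕ → Subgraph (U n)
  around t b = arc (origin b) (suc (b + t))

  private
    [n∸b]+[b+i]≡i+n : ∀ b i → b ≤ n → n ∸ b + (b + i) ≡ i + n
    [n∸b]+[b+i]≡i+n b i b≤n = ≡.trans (≡.sym (ℕₚ.+-assoc (n ∸ b) b i))
      (≡.trans (≡.cong (_+ i) (m∸n+n≡m b≤n)) (ℕₚ.+-comm n i))

    [n∸b]+[b∸1+i]≡n∸1+i : ∀ {b i} → i < b → b ≤ n → n ∸ b + (b ∸ suc i) ≡ n ∸ suc i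
    [n∸b]+[b∸1+i]≡n∸1+i {b} i<b b≤n = ≡.trans (≡.sym (ℕₚ.+-∸-assoc (n ∸ b) i<b))
      (≡.cong (_∸ suc _) (m∸n+n≡m b≤n))

    [n∸b]+[n∸1]≡n∸1+b+n : ∀ {b} → b < n → n ∸ b + (n ∸ 1) ≡ n ∸ suc b + n
    [n∸b]+[n∸1]≡n∸1+b+n {b} b<n = begin
      n ∸ b + (n ∸ 1)          ≡⟨ ≡.cong (_+ (n ∸ 1)) (ℕₚ.+-∸-assoc 1 b<n) ⟩
      suc (n ∸ suc b) + (n ∸ 1) ≡⟨ ℕₚ.+-suc (n ∸ suc b) (n ∸ 1) ⟨
      n ∸ suc b + suc (n ∸ 1)   ≡⟨ ≡.cong (n ∸ suc b +_) (ℕₚ.suc-pred n) ⟩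
      n ∸ suc b + n             ∎
      where open ≡.≡-Reasoning

  origin-forward : ∀ {b} i → b ≤ n → origin b ⊞ (b + i) ≡ j ⊞ i
  origin-forward {b} i b≤n = ≡.trans (⊞-assoc j (n ∸ b) (b + i))
    (≡.trans (≡.cong (j ⊞_) ([n∸b]+[b+i]≡i+n b i b≤n)) (⊞-+n j i))

  origin-backward : ∀ {b i} → i < b → b ≤ n → origin b ⊞ (b ∸ suc i) ≡ j ⊞ (n ∸ suc i)
  origin-backward i<b b≤n = ≡.trans (⊞-assoc j _ _) (≡.cong (j ⊞_) ([n∸b]+[b∸1+i]≡n∸1+i i<b b≤n))

  origin-entering : ∀ {b} → b < n → origin b ⊞ (n ∸ 1) ≡ j ⊞ (n ∸ suc b)
  origin-entering b<n = ≡.trans (⊞-assoc j _ _)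
    (≡.trans (≡.cong (j ⊞_) ([n∸b]+[n∸1]≡n∸1+b+n b<n)) (⊞-+n j _))

  origin-⊞-self : ∀ {b} → b ≤ n → origin b ⊞ b ≡ j
  origin-⊞-self {b} b≤n = ≡.trans (≡.cong (origin b ⊞_) (≡.sym (ℕₚ.+-identityʳ b)))
    (≡.trans (origin-forward 0 b≤n) (⊞-0 j))

  offset-origin : ∀ {b} → b < n → offset (origin b) j ≡ b
  offset-origin {b} b<n = ≡.trans (≡.cong (offset (origin b)) (≡.sym (origin-⊞-self (<⇒≤ b<n))))
    (offset-⊞< (origin b) b<n)

  module _ {t b : ℕ} (b+t<n : b + t < n) where

    private
      b≤n : b ≤ n
      b≤n = ≤-trans (ℕₚ.m≤m+n b t) (<⇒≤ b+t<n)

    around-isSubtree : SubtreeContaining (U n) j (around t b)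
    around-isSubtree = arc-isSubtree (origin b) (suc (b + t)) b+t<n (s≤s z≤n) ,
      ≡.subst (InV (around t b)) (origin-⊞-self b≤n)
        (arc-vertex-⊞ (origin b) (suc (b + t)) b+t<n (s≤s (ℕₚ.m≤m+n b t)))

    around-forward : ∀ {i} → i < t → InE (around t b) (j ⊞ i)
    around-forward {i} i<t = ≡.subst (InE (around t b)) (origin-forward i b≤n)
      (arc-edge-⊞ (origin b) (suc (b + t)) b+t<n (s≤s (ℕₚ.+-monoʳ-< b i<t)))

    around-∌-forward : ¬ InE (around t b) (j ⊞ t)
    around-∌-forward e∈ = arc-∌-⊞ (origin b) (suc (b + t)) b+t<n ≤-refl
      (≡.subst (InE (around t b)) (≡.sym (origin-forward t b≤n)) e∈)

    around-backward : ∀ {i} → i < b → InE (around t b) (j ⊞ (n ∸ suc i))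
    around-backward {i} i<b = ≡.subst (InE (around t b)) (origin-backward i<b b≤n)
      (arc-edge-⊞ (origin b) (suc (b + t)) b+t<n (s≤s (<-≤-trans (ℕₚ.∸-monoʳ-< (s≤s z≤n) i<b) (ℕₚ.m≤m+n b t))))

    around-∌-backward : ¬ InE (around t b) (j ⊞ (n ∸ suc b))
    around-∌-backward e∈ = arc-∌-⊞ (origin b) (suc (b + t)) (ℕₚ.∸-monoʳ-< (s≤s z≤n) (>-nonZero⁻¹ n))
      (≡.subst (suc (b + t) ≤_) (≡.sym (ℕₚ.suc-pred n)) b+t<n)
      (≡.subst (InE (around t b)) (≡.sym (origin-entering (≤-<-trans (ℕₚ.m≤m+n b t) b+t<n))) e∈)

  around-injective : ∀ {t b t′ b′} → b + t < n → b′ + t′ < n → around t b ≡ around t′ b′ → t ≡ t′ × b ≡ b′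
  around-injective {t} {b} {t′} {b′} h h′ eq with <-cmp t t′
  ... | tri< t<t′ _ _ = ⊥-elim (around-∌-forward h (≡.subst (λ S → InE S (j ⊞ t)) (≡.sym eq) (around-forward h′ t<t′)))
  ... | tri> _ _ t>t′ = ⊥-elim (around-∌-forward h′ (≡.subst (λ S → InE S (j ⊞ t′)) eq (around-forward h t>t′)))
  ... | tri≈ _ ≡.refl _ with <-cmp b b′
  ...   | tri< b<b′ _ _ = ⊥-elim (around-∌-backward h (≡.subst (λ S → InE S _) (≡.sym eq) (around-backward h′ b<b′)))
  ...   | tri> _ _ b>b′ = ⊥-elim (around-∌-backward h′ (≡.subst (λ S → InE S _) eq (around-backward h b>b′)))
  ...   | tri≈ _ ≡.refl _ = ≡.refl , ≡.refl

  -- t is the number of consecutive edges of S after v_j and b the number before it;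
  -- acyclicity guarantees that some edge of the cycle is missing.
  subtree⇒around : ∀ {S} → SubtreeContaining (U n) j S → ∃₂ λ t b → b + t < n × S ≡ around t b
  subtree⇒around {S} ((sub , _ , conn , acyclic) , j∈)
    with least-counterexample (λ k → InE? S (j ⊞ k)) n
  ... | inj₁ all-forward = ⊥-elim (acyclic (U-cycle n S λ e →
          ≡.subst (InE S) (⊞-offset j e) (all-forward (offset<n j e))))
  ... | inj₂ (t , t<n , forward , ¬t) with least-counterexample (λ k → InE? S (j ⊞ (n ∸ suc k))) (n ∸ t)
  ...   | inj₁ all-backward = ⊥-elim (¬t (≡.subst (InE S) (≡.cong (j ⊞_) (b∸[1+b∸1+i]≡i t<n))
            (all-backward (ℕₚ.∸-monoʳ-< (n<1+n t) t<n))))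
  ...   | inj₂ (b , b<n∸t , backward , ¬b) =
            t , b , b+t<n , subgraph≡arc sub conn (origin b) (b + t) b+t<n inner ¬last ¬first j∈
                              (≡.subst (_≤ b + t) (≡.sym (offset-origin b<n)) (ℕₚ.m≤m+n b t))
    where
    b+t<n : b + t < n
    b+t<n = <∸⇒+< (<⇒≤ t<n) b<n∸t
    b<n : b < n
    b<n = ≤-<-trans (ℕₚ.m≤m+n b t) b+t<n
    inner : ∀ {i} → i < b + t → InE S (origin b ⊞ i)
    inner {i} i<b+t with i <? b
    ... | yes i<b = ≡.subst (InE S)
                      (≡.trans (≡.sym (origin-backward i′<b (<⇒≤ b<n))) (≡.cong (origin b ⊞_) (b∸[1+b∸1+i]≡i i<b)))
                      (backward i′<b)
      where
      i′<b : b ∸ suc i < b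
      i′<b = ℕₚ.∸-monoʳ-< (s≤s z≤n) i<b
    ... | no  i≮b = ≡.subst (InE S)
                      (≡.trans (≡.sym (origin-forward (i ∸ b) (<⇒≤ b<n))) (≡.cong (origin b ⊞_) (m+[n∸m]≡n (≮⇒≥ i≮b))))
                      (forward (≡.subst (i ∸ b <_) (ℕₚ.m+n∸m≡n b t) (ℕₚ.∸-monoˡ-< i<b+t (≮⇒≥ i≮b))))
    ¬last : ¬ InE S (origin b ⊞ (b + t))
    ¬last = ¬t ∘ ≡.subst (InE S) (origin-forward t (<⇒≤ b<n))
    ¬first : ¬ InE S (origin b ⊞ (n ∸ 1))
    ¬first = ¬b ∘ ≡.subst (InE S) (origin-entering b<n)

module Enumeration (n : ℕ) .{{_ : NonZero n}} (j : Fin n) where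
  open Around n j

  row : ℕ → List (Subgraph (U n))
  row t = concat< (n ∸ t) (λ b → [ around t b ])

  subtrees : List (Subgraph (U n))
  subtrees = concat< n row

  ∈-subtrees⁻ : ∀ {S} → S ∈ subtrees → ∃₂ λ t b → b + t < n × S ≡ around t b
  ∈-subtrees⁻ S∈ with ∈-concat<⁻ n row S∈
  ... | t , t<n , S∈ᵗ with ∈-concat<⁻ (n ∸ t) (λ b → [ around t b ]) S∈ᵗ
  ...   | b , b<n∸t , here S≡ = t , b , <∸⇒+< (<⇒≤ t<n) b<n∸t , S≡

  ∈-subtrees⁺ : ∀ {t b} → b + t < n → around t b ∈ subtrees
  ∈-subtrees⁺ {t} {b} b+t<n = ∈-concat<⁺ n row (≤-<-trans (ℕₚ.m≤n+m t b) b+t<n)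
    (∈-concat<⁺ (n ∸ t) (λ b → [ around t b ]) (ℕₚ.m+n≤o⇒m≤o∸n (suc b) b+t<n) (here ≡.refl))

  subtrees-unique : Unique subtrees
  subtrees-unique = concat<-unique n row row-unique rows-disjoint
    where
    row-unique : ∀ t → t < n → Unique (row t)
    row-unique t t<n = concat<-unique (n ∸ t) (λ b → [ around t b ]) (λ _ _ → All.[] ∷ [])
      λ { b<b′ b′<n∸t (here ≡.refl) (here eq) →
            ℕₚ.<-irrefl (proj₂ (around-injective (<∸⇒+< (<⇒≤ t<n) (ℕₚ.<-trans b<b′ b′<n∸t))
                                                 (<∸⇒+< (<⇒≤ t<n) b′<n∸t) eq)) b<b′ }
    rows-disjoint : ∀ {t t′ S} → t < t′ → t′ < n → S ∈ row t → S ∈ row t′ → ⊥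
    rows-disjoint {t} {t′} t<t′ t′<n S∈ S∈′
      with ∈-concat<⁻ (n ∸ t) (λ b → [ around t b ]) S∈ | ∈-concat<⁻ (n ∸ t′) (λ b → [ around t′ b ]) S∈′
    ... | b , b<n∸t , here ≡.refl | b′ , b′<n∸t′ , here eq =
      ℕₚ.<-irrefl (proj₁ (around-injective (<∸⇒+< (<⇒≤ (ℕₚ.<-trans t<t′ t′<n)) b<n∸t)
                                           (<∸⇒+< (<⇒≤ t′<n) b′<n∸t′) eq)) t<t′

  subtrees-enumerate : EnumeratesSubtrees (U n) j subtrees
  subtrees-enumerate = subtrees-unique , λ S → mk⇔
    (λ S∈ → let (t , b , b+t<n , S≡) = ∈-subtrees⁻ S∈ in
      ≡.subst (SubtreeContaining (U n) j) (≡.sym S≡) (around-isSubtree {t} {b} b+t<n))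
    (λ S-subtree → let (t , b , b+t<n , S≡) = subtree⇒around S-subtree in
      ≡.subst (_∈ subtrees) (≡.sym S≡) (∈-subtrees⁺ {t} {b} b+t<n))

module Weights {c ℓ : Level} (R : CommutativeRing c ℓ) (n : ℕ) .{{_ : NonZero n}} where
  open CommutativeRing R renaming (_+_ to _⊕_; _*_ to _⊛_)
  open import Relation.Binary.Reasoning.Setoid setoid
  open Cyclic n
  open Arcs n

  ∏List-indicator : ∀ (s : Fin n) (h : Fin n → Carrier) (B : Fin n → Bool) {p} → p ≤ n →
    (∀ {i} → i < p → B (s ⊞ i) ≡ true) → (∀ {i} → p ≤ i → i < n → B (s ⊞ i) ≡ false) →
    ∏List R (map (λ v → if B v then h v else 1#) (allFin n)) ≈ ∏< R p (λ i → h (s ⊞ i))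
  ∏List-indicator s h B {p} p≤n inside outside = begin
    ∏List R (map H (allFin n))
      ≈⟨ ∏List-map-tabulate R n (λ v → v) H (λ i → H (idx n i)) (λ v → reflexive (≡.cong H (idx-toℕ v))) ⟩
    ∏< R n (λ i → H (idx n i))
      ≈⟨ ∏<-rotate R n (λ i → H (idx n i)) (toℕ s) (<⇒≤ (toℕ<n s)) (λ i → reflexive (≡.cong H (n+i≡i i))) ⟩
    ∏< R n (λ i → H (s ⊞ i))
      ≡⟨ ≡.cong (λ k → ∏< R k (λ i → H (s ⊞ i))) (m∸n+n≡m p≤n) ⟨
    ∏< R (n ∸ p + p) (λ i → H (s ⊞ i))
      ≈⟨ ∏<-split R p (n ∸ p) (λ i → H (s ⊞ i)) ⟩
    ∏< R p (λ i → H (s ⊞ i)) ⊛ ∏< R (n ∸ p) (λ i → H (s ⊞ (p + i)))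
      ≈⟨ *-cong (∏<-cong R p (λ i i<p → reflexive (≡.cong (λ b → if b then h (s ⊞ i) else 1#) (inside i<p))))
                (∏<-identity R (n ∸ p) _ (λ i i<n∸p → reflexive (≡.cong (λ b → if b then h _ else 1#)
                  (outside (ℕₚ.m≤m+n p i) (≡.subst (p + i <_) (m+[n∸m]≡n p≤n) (ℕₚ.+-monoʳ-< p i<n∸p)))))) ⟩
    ∏< R p (λ i → h (s ⊞ i)) ⊛ 1#
      ≈⟨ *-identityʳ _ ⟩
    ∏< R p (λ i → h (s ⊞ i))
      ∎
    where
    H : Fin n → Carrier
    H v = if B v then h v else 1#
    n+i≡i : ∀ i → idx n (n + i) ≡ idx n i
    n+i≡i i = ≡.trans (≡.cong (idx n) (ℕₚ.+-comm n i)) (idx-+n i)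

  ω-arc : ∀ (f g : Fin n → Carrier) s {k} → k < n →
    ω R (U n) f g (arc s (suc k)) ≈ ∏< R (suc k) (λ i → f (s ⊞ i)) ⊛ ∏< R k (λ i → g (s ⊞ i))
  ω-arc f g s {k} k<n = *-cong
    (∏List-indicator s f _ k<n
      (λ {i} i<1+k → ≡.trans (vertex-bit (<-≤-trans i<1+k k<n)) (dec-true (i <? suc k) i<1+k))
      (λ {i} 1+k≤i i<n → ≡.trans (vertex-bit i<n) (dec-false (i <? suc k) (ℕₚ.≤⇒≯ 1+k≤i))))
    (∏List-indicator s g _ (<⇒≤ k<n)
      (λ {i} i<k → ≡.trans (edge-bit (ℕₚ.<-trans i<k k<n)) (dec-true (suc i <? suc k) (s≤s i<k)))
      (λ {i} k≤i i<n → ≡.trans (edge-bit i<n) (dec-false (suc i <? suc k) (ℕₚ.≤⇒≯ (s≤s k≤i)))))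
    where
    vertex-bit : ∀ {i} → i < n → Vec.lookup (vs (arc s (suc k))) (s ⊞ i) ≡ does (i <? suc k)
    vertex-bit {i} i<n = ≡.trans (lookup∘tabulate _ (s ⊞ i)) (≡.cong (λ o → does (o <? suc k)) (offset-⊞< s i<n))
    edge-bit : ∀ {i} → i < n → Vec.lookup (es (arc s (suc k))) (s ⊞ i) ≡ does (suc i <? suc k)
    edge-bit {i} i<n = ≡.trans (lookup∘tabulate _ (s ⊞ i)) (≡.cong (λ o → does (suc o <? suc k)) (offset-⊞< s i<n))

module AroundWeights {c ℓ : Level} (R : CommutativeRing c ℓ) (n : ℕ) .{{_ : NonZero n}}
                      (j : Fin n) (f g : Fin n → CommutativeRing.Carrier R) where
  open CommutativeRing R renaming (_+_ to _⊕_; _*_ to _⊛_)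
  open import Relation.Binary.Reasoning.Setoid setoid
  open Cyclic n
  open Around n j
  open Enumeration n j
  open Weights R n

  private
    J : ℕ
    J = toℕ j

  forward-factor : ℕ → Carrier
  forward-factor k = g (idx n (J + k)) ⊛ f (idx n (J + k + 1))

  backward-factor : ℕ → Carrier
  backward-factor k = g (idx n (n + J ∸ k ∸ 1)) ⊛ f (idx n (n + J ∸ k ∸ 1))

  ω-around : ∀ {t b} → b + t < n →
    ω R (U n) f g (around t b) ≈ (f (idx n J) ⊛ ∏< R t forward-factor) ⊛ ∏< R b backward-factor
  ω-around {t} {b} b+t<n = begin
    ω R (U n) f g (around t b)
      ≈⟨ ω-arc f g (origin b) b+t<n ⟩
    ∏< R (suc (b + t)) F ⊛ ∏< R (b + t) G
      ≈⟨ ∏<-path-split R b t F G ⟩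
    (F b ⊛ ∏< R t (λ i → G (b + i) ⊛ F (b + suc i))) ⊛ ∏< R b (λ i → G i ⊛ F i)
      ≈⟨ *-congˡ (∏<-reverse R b (λ i → G i ⊛ F i)) ⟩
    (F b ⊛ ∏< R t (λ i → G (b + i) ⊛ F (b + suc i))) ⊛ ∏< R b (λ i → G (b ∸ suc i) ⊛ F (b ∸ suc i))
      ≈⟨ *-cong (*-cong (reflexive (≡.cong f centre)) (∏<-cong R t (λ i _ → reflexive (forward i))))
                (∏<-cong R b (λ i i<b → reflexive (≡.cong (λ v → g v ⊛ f v) (backward i<b)))) ⟩
    (f (idx n J) ⊛ ∏< R t forward-factor) ⊛ ∏< R b backward-factor
      ∎
    where
    F G : ℕ → Carrier
    F i = f (origin b ⊞ i)
    G i = g (origin b ⊞ i)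
    b≤n : b ≤ n
    b≤n = ≤-trans (ℕₚ.m≤m+n b t) (<⇒≤ b+t<n)
    centre : origin b ⊞ b ≡ idx n J
    centre = ≡.trans (origin-⊞-self b≤n) (≡.sym (idx-toℕ j))
    forward : ∀ i → G (b + i) ⊛ F (b + suc i) ≡ forward-factor i
    forward i = ≡.cong₂ (λ u v → g u ⊛ f v) (origin-forward i b≤n)
                  (≡.trans (origin-forward (suc i) b≤n) (≡.cong (idx n) (m+1+k≡m+k+1 J i)))
    backward : ∀ {i} → i < b → origin b ⊞ (b ∸ suc i) ≡ idx n (n + J ∸ i ∸ 1)
    backward i<b = ≡.trans (origin-backward i<b b≤n) (≡.cong (idx n) (m+[n∸1+k]≡n+m∸k∸1 J (<-≤-trans i<b b≤n)))

  ∑-row : ∀ {t} → t < n → ∑List R (map (ω R (U n) f g) (row t)) ≈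
    (f (idx n J) ⊛ ∏< R t forward-factor) ⊛ (1# ⊕ ∑< R (n ∸ suc t) (λ s → ∏< R (suc s) backward-factor))
  ∑-row {t} t<n = begin
    ∑List R (map (ω R (U n) f g) (row t))
      ≈⟨ ∑List-map-concat< R (ω R (U n) f g) (n ∸ t) (λ b → [ around t b ]) ⟩
    ∑< R (n ∸ t) (λ b → ω R (U n) f g (around t b) ⊕ 0#)
      ≈⟨ ∑<-cong R (n ∸ t) (λ b b<n∸t → trans (+-identityʳ _) (ω-around {t} {b} (<∸⇒+< (<⇒≤ t<n) b<n∸t))) ⟩
    ∑< R (n ∸ t) (λ b → X ⊛ ∏< R b backward-factor)
      ≈⟨ *-distribˡ-∑< R X (n ∸ t) _ ⟨
    X ⊛ ∑< R (n ∸ t) (λ b → ∏< R b backward-factor)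
      ≡⟨ ≡.cong (λ k → X ⊛ ∑< R k (λ b → ∏< R b backward-factor)) (ℕₚ.+-∸-assoc 1 t<n) ⟩
    X ⊛ ∑< R (suc (n ∸ suc t)) (λ b → ∏< R b backward-factor)
      ≈⟨ *-congˡ (∑<-suc R (n ∸ suc t) _) ⟩
    X ⊛ (1# ⊕ ∑< R (n ∸ suc t) (λ s → ∏< R (suc s) backward-factor))
      ∎
    where
    X = f (idx n J) ⊛ ∏< R t forward-factor

  F-along-subtrees : F-along R (U n) f g subtrees ≈ RHS R n f g j
  F-along-subtrees = trans (∑List-map-concat< R (ω R (U n) f g) n row) (∑<-cong R n (λ t t<n → ∑-row t<n))

theorem2p2 : ∀ {c ℓ} (R : CommutativeRing c ℓ) (n : ℕ) .{{_ : NonZero n}} → 2 ≤ n →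
    (f g : Fin n → CommutativeRing.Carrier R) (j : Fin n) →
    (L : List (Subgraph (U n))) → EnumeratesSubtrees (U n) j L →
    CommutativeRing._≈_ R (F-along R (U n) f g L) (RHS R n f g j)
theorem2p2 R n _ f g j L L-enumerates = begin
  F-along R (U n) f g L         ≈⟨ ∑List-map-↭ R (ω R (U n) f g) (enumerations-↭ L-enumerates subtrees-enumerate) ⟩
  F-along R (U n) f g subtrees  ≈⟨ F-along-subtrees ⟩
  RHS R n f g j                 ∎
  where
  open CommutativeRing R using (setoid)
  open import Relation.Binary.Reasoning.Setoid setoid
  open Enumeration n j
  open AroundWeights R n j f g
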